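{- Let $G$ be a tree on $n$ vertices rooted at an arbitrary vertex, let $H_0$ be the tree produced by Algorithm Bracket Builder on $G$, and let $H_1$ be the binary tree on $V(G)$ obtained by running Algorithm Tournament Runner on $H_0$. Then \[ \sum_{uv\in E(G)}\operatorname{dist}_{H_1}(u,v)-\sum_{uv\in E(G)}\operatorname{dist}_{H_0}(u,v)\ \le\ n-1 . \]
   Context: For $v\in V(G)$, $c_v$ is the number of children of $v$ in $G$, and $p$ the parent function. Algorithm Bracket Builder: for every $v\in V(G)$ with $c_v\ge 1$, build a complete binary tree $T'_v$ in which every inner node has exactly two children, whose leaves are exactly the children of $v$ in $G$ and whose inner nodes are new Steiner nodes (nodes not in $V(G)$); link $v$ to the root of $T'_v$. The output $H_0$ is the union of these trees, rooted at the root of $G$ (each non-root $w\in V(G)$ is a leaf of $T'_{p(w)}$ and is linked to the root of $T'_w$). Algorithm Tournament Runner: while a Steiner node remains, pick a Steiner node $s$ both of whose children $x,y$ are vertices of $G$ (a "match"); the winner is $x$ if $c_x\le c_y$ (ties broken arbitrarily), say $x$ wins. Then $x$ takes the place of $s$ (linked to the former parent of $s$), $y$ becomes the only child of $x$, and the former child subtree of $x$ (if any) becomes a child subtree of $y$ in addition to $y$'s own former child subtree. $\operatorname{dist}_H$ denotes shortest-path distance in $H$. -}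

module Defs where

open import Data.Nat using (ℕ; zero; suc; _+_; _*_; _∸_; _≤_; _≟_)
open import Data.Bool using (Bool; true; false; if_then_else_)
open import Data.List using (List; []; _∷_; _++_; length; map)
open import Data.Nat.ListAction using (sum)
open import Data.Maybe using (Maybe; just; nothing)
open import Data.Product using (_×_; _,_; proj₁; proj₂)
open import Relation.Nullary.Decidable using (⌊_⌋)
open import Data.List.Relation.Binary.Permutation.Propositional using (_↭_)

data Tree (A : Set) : Set where
  node : A → List (Tree A) → Tree A

root : {A : Set} → Tree A → A
root (node a _) = a

mutual
  labels : {A : Set} → Tree A → List A
  labels (node a ts) = a ∷ labelsL ts

  labelsL : {A : Set} → List (Tree A) → List A
  labelsL [] = []
  labelsL (t ∷ ts) = labels t ++ labelsL ts

-- G is a Tree ℕ with pairwise distinct labels (the vertices of G).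

mutual
  -- c_v : number of children of the vertex v in G
  -- (labels are assumed unique, so at most one summand is nonzero)
  childCount : Tree ℕ → ℕ → ℕ
  childCount (node a ts) v = if ⌊ a ≟ v ⌋ then length ts else childCountL ts v

  childCountL : List (Tree ℕ) → ℕ → ℕ
  childCountL [] v = 0
  childCountL (t ∷ ts) v = childCount t v + childCountL ts v

mutual
  edges : Tree ℕ → List (ℕ × ℕ)
  edges (node a ts) = map (λ t → (a , root t)) ts ++ edgesL ts

  edgesL : List (Tree ℕ) → List (ℕ × ℕ)
  edgesL [] = []
  edgesL (t ∷ ts) = edges t ++ edgesL ts

-- Trees H: label (just v) is the vertex v of G, label nothing is a Steiner node.
HTree : Set
HTree = Tree (Maybe ℕ)

isV : ℕ → Maybe ℕ → Bool
isV u (just x) = ⌊ x ≟ u ⌋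
isV u nothing = false

mutual
  -- position (path of child indices from the root) of the node labelled (just u)
  pos : ℕ → HTree → Maybe (List ℕ)
  pos u (node a ts) = if isV u a then just [] else posL u 0 ts

  posL : ℕ → ℕ → List HTree → Maybe (List ℕ)
  posL u i [] = nothing
  posL u i (t ∷ ts) with pos u t
  ... | just p = just (i ∷ p)
  ... | nothing = posL u (suc i) ts

lcp : List ℕ → List ℕ → ℕ
lcp (a ∷ as) (b ∷ bs) = if ⌊ a ≟ b ⌋ then suc (lcp as bs) else 0
lcp _ _ = 0

-- dist_H(u,v): path length in the tree H (0 if u or v does not occur)
dist : HTree → ℕ → ℕ → ℕ
dist H u v with pos u H | pos v H
... | just p | just q = length p + length q ∸ 2 * lcp p q
... | _ | _ = 0

sumDist : HTree → List (ℕ × ℕ) → ℕ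
sumDist H es = sum (map (λ e → dist H (proj₁ e) (proj₂ e)) es)

-- Full binary tree (every inner node a Steiner node with exactly two children)
-- whose leaves, from left to right, are the given subtrees.
data FullBin : List HTree → HTree → Set where
  leafB : ∀ {h} → FullBin (h ∷ []) h
  brB   : ∀ {l₁ l₂ a b} → FullBin l₁ a → FullBin l₂ b →
          FullBin (l₁ ++ l₂) (node nothing (a ∷ b ∷ []))

-- Algorithm Bracket Builder (as a relation: all possible outputs)
mutual
  data BB : Tree ℕ → HTree → Set where
    bb-leaf : ∀ {v} → BB (node v []) (node (just v) [])
    bb-node : ∀ {v c cs hs ls T} → BBs (c ∷ cs) hs → hs ↭ ls → FullBin ls T →
              BB (node v (c ∷ cs)) (node (just v) (T ∷ []))

  data BBs : List (Tree ℕ) → List HTree → Set where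
    []  : BBs [] []
    _∷_ : ∀ {t ts h hs} → BB t h → BBs ts hs → BBs (t ∷ ts) (h ∷ hs)

-- One match of Algorithm Tournament Runner (c = child counts in G),
-- performed at any Steiner node both of whose children are vertices of G.
mutual
  data Step (c : ℕ → ℕ) : HTree → HTree → Set where
    winL   : ∀ {x y xs ys} → c x ≤ c y →
             Step c (node nothing (node (just x) xs ∷ node (just y) ys ∷ []))
                    (node (just x) (node (just y) (ys ++ xs) ∷ []))
    winR   : ∀ {x y xs ys} → c y ≤ c x →
             Step c (node nothing (node (just x) xs ∷ node (just y) ys ∷ []))
                    (node (just y) (node (just x) (xs ++ ys) ∷ []))
    inside : ∀ {a ts ts'} → StepL c ts ts' → Step c (node a ts) (node a ts')

  data StepL (c : ℕ → ℕ) : List HTree → List HTree → Set where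
    here  : ∀ {t t' ts} → Step c t t' → StepL c (t ∷ ts) (t' ∷ ts)
    there : ∀ {t ts ts'} → StepL c ts ts' → StepL c (t ∷ ts) (t ∷ ts')

-- Call a vertex pending while its parent is a Steiner node, and consider the potential
-- Φ(H) = Σ_{uv ∈ E(G)} dist_H(u,v) + Σ_{w pending} c_w.  Throughout the tournament every
-- edge uv of G keeps u an ancestor of v.  In a match of x against y won by x, only x moves
-- (one level up), so the distance sum grows by at most the number c_x of edges of G from x
-- to its children, while y stops being pending.  Since c_x ≤ c_y, Φ never increases.  In
-- H₀ the pending vertices are non-root vertices of G, and Σ_{w ≠ root} c_w ≤ n − 1.
module Submission where

open import Defs
open import Data.Bool using (true; false; if_then_else_)
open import Data.Empty using (⊥; ⊥-elim)
open import Function using (_∘′_)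
open import Data.Fin using (toℕ)
open import Data.List using (List; []; _∷_; _++_; length; map)
import Data.List.Properties as List
open import Data.List.Membership.Propositional using (_∈_; _∉_)
open import Data.List.Membership.Propositional.Properties using (∈-++⁺ˡ; ∈-++⁺ʳ; ∈-++⁻)
open import Data.List.Relation.Binary.Permutation.Propositional
  using (_↭_; prep; swap; ↭-refl; ↭-sym; ↭-trans; ↭⇒↭ₛ)
  renaming (refl to ↭-reflexive; trans to ↭-transitive)
import Data.List.Relation.Binary.Permutation.Propositional.Properties as ↭
import Data.List.Relation.Binary.Permutation.Setoid.Properties as ↭ₛ
open import Data.List.Relation.Unary.All using (All; []; _∷_)
import Data.List.Relation.Unary.All as All
import Data.List.Relation.Unary.All.Properties as All
open import Data.List.Relation.Unary.Any using (here; there; index)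
open import Data.List.Relation.Unary.Unique.Propositional using (Unique; []; _∷_; tail)
open import Data.List.Relation.Unary.Unique.Propositional.Properties using (Unique[x∷xs]⇒x∉xs)
open import Data.Maybe using (Maybe; just; nothing; Is-just; _<∣>_)
import Data.Maybe as Maybe
open import Data.Maybe.Properties using (map-<∣>; <∣>-assoc; <∣>-identityʳ)
open import Data.Nat using (ℕ; suc; _+_; _*_; _∸_; _≤_; _≟_; z≤n; s≤s)
open import Data.Nat.Properties
open import Algebra.Properties.CommutativeSemigroup +-commutativeSemigroup
  using (x∙yz≈y∙xz; xy∙z≈xz∙y; interchange)
open import Data.Nat.Tactic.RingSolver using (solve-∀)
open import Data.Product using (∃; ∃₂; _×_; _,_; proj₁; proj₂)
open import Data.Sum using (_⊎_; inj₁; inj₂)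
open import Data.Unit using (⊤; tt)
open import Relation.Binary.Construct.Closure.ReflexiveTransitive using (Star; ε; _◅_)
open import Relation.Binary.PropositionalEquality
open import Relation.Binary.PropositionalEquality.Properties using (setoid)
open import Relation.Nullary using (yes; no)
open import Relation.Nullary.Decidable using (⌊_⌋)

module _ {a} {A : Set a} where

  Unique-resp-↭ : ∀ {xs ys : List A} → xs ↭ ys → Unique xs → Unique ys
  Unique-resp-↭ p = ↭ₛ.Unique-resp-↭ (setoid A) (↭⇒↭ₛ p)

  Unique-++⁻ˡ : ∀ xs {ys : List A} → Unique (xs ++ ys) → Unique xs
  Unique-++⁻ˡ []       u        = []
  Unique-++⁻ˡ (x ∷ xs) (x∉ ∷ u) = All.++⁻ˡ xs x∉ ∷ Unique-++⁻ˡ xs u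

  Unique-++⁻ʳ : ∀ xs {ys : List A} → Unique (xs ++ ys) → Unique ys
  Unique-++⁻ʳ []       u = u
  Unique-++⁻ʳ (x ∷ xs) u = Unique-++⁻ʳ xs (tail u)

  Unique-++-disjoint : ∀ xs {ys : List A} {z} → Unique (xs ++ ys) → z ∈ xs → z ∈ ys → ⊥
  Unique-++-disjoint (x ∷ xs) (x∉ ∷ _) (here refl)  z∈ys = All.lookup (All.++⁻ʳ xs x∉) z∈ys refl
  Unique-++-disjoint (x ∷ xs) (_ ∷ u)  (there z∈xs) z∈ys = Unique-++-disjoint xs u z∈xs z∈ys

map-<∣>-assoc : ∀ {A B : Set} (f : A → B) a b c →
                Maybe.map f a <∣> (Maybe.map f b <∣> c) ≡ Maybe.map f (a <∣> b) <∣> c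
map-<∣>-assoc f a b c =
  sym (trans (cong (_<∣> c) (map-<∣> f a b)) (<∣>-assoc (Maybe.map f a) (Maybe.map f b) c))

mutual
  vertices : HTree → List ℕ
  vertices (node (just v) ts) = v ∷ verticesL ts
  vertices (node nothing ts)  = verticesL ts

  verticesL : List HTree → List ℕ
  verticesL []       = []
  verticesL (t ∷ ts) = vertices t ++ verticesL ts

verticesL-++ : ∀ xs ys → verticesL (xs ++ ys) ≡ verticesL xs ++ verticesL ys
verticesL-++ []       ys = refl
verticesL-++ (x ∷ xs) ys =
  trans (cong (vertices x ++_) (verticesL-++ xs ys)) (sym (List.++-assoc (vertices x) (verticesL xs) (verticesL ys)))

verticesL-↭ : ∀ {xs ys} → xs ↭ ys → verticesL xs ↭ verticesL ys
verticesL-↭ ↭-reflexive          = ↭-refl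
verticesL-↭ (prep x p)           = ↭.++⁺ˡ (vertices x) (verticesL-↭ p)
verticesL-↭ (swap x y p)         =
  ↭-trans (↭.shifts (vertices x) (vertices y)) (↭.++⁺ˡ (vertices y) (↭.++⁺ˡ (vertices x) (verticesL-↭ p)))
verticesL-↭ (↭-transitive p q) = ↭-trans (verticesL-↭ p) (verticesL-↭ q)

∈-verticesL : ∀ {w t ts} → t ∈ ts → w ∈ vertices t → w ∈ verticesL ts
∈-verticesL {ts = t ∷ ts} (here refl) w∈t = ∈-++⁺ˡ w∈t
∈-verticesL {ts = t ∷ ts} (there t∈ts) w∈t = ∈-++⁺ʳ (vertices t) (∈-verticesL t∈ts w∈t)

∈-verticesL-++⁺ˡ : ∀ {w} xs ys → w ∈ verticesL xs → w ∈ verticesL (xs ++ ys)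
∈-verticesL-++⁺ˡ xs ys w∈xs rewrite verticesL-++ xs ys = ∈-++⁺ˡ w∈xs

∈-verticesL-++⁺ʳ : ∀ {w} xs ys → w ∈ verticesL ys → w ∈ verticesL (xs ++ ys)
∈-verticesL-++⁺ʳ xs ys w∈ys rewrite verticesL-++ xs ys = ∈-++⁺ʳ (verticesL xs) w∈ys

Unique-children : ∀ {a ts} → Unique (vertices (node a ts)) → Unique (verticesL ts)
Unique-children {just _}  u = tail u
Unique-children {nothing} u = u

Unique-child : ∀ {t ts} → t ∈ ts → Unique (verticesL ts) → Unique (vertices t)
Unique-child {t} (here refl) u = Unique-++⁻ˡ (vertices t) u
Unique-child {ts = t′ ∷ _} (there t∈ts) u = Unique-child t∈ts (Unique-++⁻ʳ (vertices t′) u)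

isV-below : ∀ {w a ts} → Unique (vertices (node a ts)) → w ∈ verticesL ts → isV w a ≡ false
isV-below {w} {just a} u w∈ts with a ≟ w
... | yes refl = ⊥-elim (Unique[x∷xs]⇒x∉xs u w∈ts)
... | no _     = refl
isV-below {a = nothing} u w∈ts = refl

mutual
  depth : ℕ → HTree → Maybe ℕ
  depth w (node a ts) = if isV w a then just 0 else depthL w ts

  depthL : ℕ → List HTree → Maybe ℕ
  depthL w []       = nothing
  depthL w (t ∷ ts) = Maybe.map suc (depth w t) <∣> depthL w ts

depthL-++ : ∀ w xs ys → depthL w (xs ++ ys) ≡ depthL w xs <∣> depthL w ys
depthL-++ w []       ys = refl
depthL-++ w (x ∷ xs) ys with depth w x
... | just _  = refl
... | nothing = depthL-++ w xs ys

mutual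
  length-pos : ∀ w t → Maybe.map length (pos w t) ≡ depth w t
  length-pos w (node a ts) with isV w a
  ... | true  = refl
  ... | false = length-posL w 0 ts

  length-posL : ∀ w i ts → Maybe.map length (posL w i ts) ≡ depthL w ts
  length-posL w i []       = refl
  length-posL w i (t ∷ ts) with pos w t | length-pos w t
  ... | just _  | eq rewrite sym eq = refl
  ... | nothing | eq rewrite sym eq = length-posL w (suc i) ts

mutual
  depth⇒∈ : ∀ w t {d} → depth w t ≡ just d → w ∈ vertices t
  depth⇒∈ w (node (just a) ts) eq with a ≟ w
  ... | yes refl = here refl
  ... | no _     = there (depthL⇒∈ w ts eq)
  depth⇒∈ w (node nothing ts) eq = depthL⇒∈ w ts eq

  depthL⇒∈ : ∀ w ts {d} → depthL w ts ≡ just d → w ∈ verticesL ts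
  depthL⇒∈ w (t ∷ ts) eq with depth w t in e
  ... | just _  = ∈-++⁺ˡ (depth⇒∈ w t e)
  ... | nothing = ∈-++⁺ʳ (vertices t) (depthL⇒∈ w ts eq)

∉⇒depthL≡nothing : ∀ w ts → w ∉ verticesL ts → depthL w ts ≡ nothing
∉⇒depthL≡nothing w ts w∉ts with depthL w ts in e
... | just _  = ⊥-elim (w∉ts (depthL⇒∈ w ts e))
... | nothing = refl

mutual
  ∈⇒depth : ∀ w t → w ∈ vertices t → ∃ λ d → depth w t ≡ just d
  ∈⇒depth w (node (just a) ts) w∈t with a ≟ w | w∈t
  ... | yes _  | _            = 0 , refl
  ... | no a≢w | here w≡a     = ⊥-elim (a≢w (sym w≡a))
  ... | no _   | there w∈ts   = ∈⇒depthL w ts w∈ts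
  ∈⇒depth w (node nothing ts) w∈t = ∈⇒depthL w ts w∈t

  ∈⇒depthL : ∀ w ts → w ∈ verticesL ts → ∃ λ d → depthL w ts ≡ just d
  ∈⇒depthL w (t ∷ ts) w∈ts with depth w t in e | ∈-++⁻ (vertices t) w∈ts
  ... | just d  | _          = suc d , refl
  ... | nothing | inj₂ w∈ts′ = ∈⇒depthL w ts w∈ts′
  ... | nothing | inj₁ w∈t with ∈⇒depth w t w∈t
  ...   | _ , e′ with trans (sym e) e′
  ...     | ()

∈⇒posL : ∀ w i ts → w ∈ verticesL ts → ∃ λ q → posL w i ts ≡ just q
∈⇒posL w i ts w∈ts with posL w i ts | length-posL w i ts | ∈⇒depthL w ts w∈ts
... | just q  | _  | _ = q , refl
... | nothing | eq | _ , e with trans eq e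
...   | ()

pos⇒∈ : ∀ {w t p} → pos w t ≡ just p → w ∈ vertices t
pos⇒∈ {w} {t} e = depth⇒∈ w t (trans (sym (length-pos w t)) (cong (Maybe.map length) e))

posL-child : ∀ {w t ts p} (t∈ts : t ∈ ts) → Unique (verticesL ts) → pos w t ≡ just p → ∀ i →
             posL w i ts ≡ just ((i + toℕ (index t∈ts)) ∷ p)
posL-child {w} (here refl) u e i rewrite e | +-identityʳ i = refl
posL-child {w} {t} {t′ ∷ ts} (there t∈ts) u e i with pos w t′ in e′
... | just _  = ⊥-elim (Unique-++-disjoint (vertices t′) u (pos⇒∈ {w} {t′} e′) (∈-verticesL t∈ts (pos⇒∈ {w} {t} e)))
... | nothing rewrite +-suc i (toℕ (index t∈ts)) = posL-child t∈ts (Unique-++⁻ʳ (vertices t′) u) e (suc i)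

data Ancestor : HTree → ℕ → ℕ → Set where
  at-root  : ∀ {u v ts} → v ∈ verticesL ts → Ancestor (node (just u) ts) u v
  in-child : ∀ {a ts t u v} → t ∈ ts → Ancestor t u v → Ancestor (node a ts) u v

Ancestor⇒∈ˡ : ∀ {t u v} → Ancestor t u v → u ∈ vertices t
Ancestor⇒∈ˡ (at-root _) = here refl
Ancestor⇒∈ˡ (in-child {just _} t∈ts an) = there (∈-verticesL t∈ts (Ancestor⇒∈ˡ an))
Ancestor⇒∈ˡ (in-child {nothing} t∈ts an) = ∈-verticesL t∈ts (Ancestor⇒∈ˡ an)

Ancestor⇒∈ʳ : ∀ {t u v} → Ancestor t u v → v ∈ vertices t
Ancestor⇒∈ʳ (at-root v∈ts) = there v∈ts
Ancestor⇒∈ʳ (in-child {just _} t∈ts an) = there (∈-verticesL t∈ts (Ancestor⇒∈ʳ an))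
Ancestor⇒∈ʳ (in-child {nothing} t∈ts an) = ∈-verticesL t∈ts (Ancestor⇒∈ʳ an)

Ancestor⇒pos-prefix : ∀ {t u v} → Unique (vertices t) → Ancestor t u v →
                      ∃₂ λ p r → pos u t ≡ just p × pos v t ≡ just (p ++ r)
Ancestor⇒pos-prefix {node (just u) ts} {u} {v} uq (at-root v∈ts) with u ≟ u | u ≟ v
... | no u≢u | _        = ⊥-elim (u≢u refl)
... | yes _  | yes refl = ⊥-elim (Unique[x∷xs]⇒x∉xs uq v∈ts)
... | yes _  | no _ with ∈⇒posL v 0 ts v∈ts
...   | q , pv = [] , q , refl , pv
Ancestor⇒pos-prefix {node a ts} {u} {v} uq (in-child t∈ts an)
  rewrite isV-below {u} {a} uq (∈-verticesL t∈ts (Ancestor⇒∈ˡ an))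
        | isV-below {v} {a} uq (∈-verticesL t∈ts (Ancestor⇒∈ʳ an))
  with Ancestor⇒pos-prefix (Unique-child t∈ts (Unique-children {a} uq)) an
... | p , r , pu , pv =
  toℕ (index t∈ts) ∷ p , r , posL-child t∈ts (Unique-children {a} uq) pu 0 , posL-child t∈ts (Unique-children {a} uq) pv 0

lcp-++ : ∀ p r → lcp p (p ++ r) ≡ length p
lcp-++ []      r = refl
lcp-++ (a ∷ p) r rewrite ≟-diag {a} {a} refl = cong suc (lcp-++ p r)

m+[m+n]∸2*m≡n : ∀ m n → m + (m + n) ∸ 2 * m ≡ n
m+[m+n]∸2*m≡n m n rewrite +-identityʳ m | sym (+-assoc m m n) = m+n∸m≡n (m + m) n

dist-prefix : ∀ {H u v p r} → pos u H ≡ just p → pos v H ≡ just (p ++ r) → dist H u v ≡ length r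
dist-prefix {H} {u} {v} {p} {r} pu pv rewrite pu | pv | List.length-++ p {r} | lcp-++ p r =
  m+[m+n]∸2*m≡n (length p) (length r)

Ancestor⇒dist+depth : ∀ {t u v} → Unique (vertices t) → Ancestor t u v →
                      ∃₂ λ du dv → depth u t ≡ just du × depth v t ≡ just dv × dist t u v + du ≡ dv
Ancestor⇒dist+depth {t} {u} {v} uq an with Ancestor⇒pos-prefix uq an
... | p , r , pu , pv =
  length p , length (p ++ r)
  , trans (sym (length-pos u t)) (cong (Maybe.map length) pu)
  , trans (sym (length-pos v t)) (cong (Maybe.map length) pv)
  , trans (cong (_+ length p) (dist-prefix {t} {u} {v} pu pv))
          (trans (+-comm (length r) (length p)) (sym (List.length-++ p)))

δ : ℕ → ℕ → ℕ
δ x w = if ⌊ x ≟ w ⌋ then 1 else 0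

data RisesAtMost (e : ℕ) : Maybe ℕ → Maybe ℕ → Set where
  absent : RisesAtMost e nothing nothing
  rises  : ∀ {d d′} → d′ ≤ d → d ≤ d′ + e → RisesAtMost e (just d) (just d′)

RisesAtMost-refl : ∀ e m → RisesAtMost e m m
RisesAtMost-refl e nothing  = absent
RisesAtMost-refl e (just d) = rises ≤-refl (m≤m+n d e)

RisesAtMost-depthL : ∀ {e a a′ b b′} → RisesAtMost e a a′ → RisesAtMost e b b′ →
                     RisesAtMost e (Maybe.map suc a <∣> b) (Maybe.map suc a′ <∣> b′)
RisesAtMost-depthL absent      r = r
RisesAtMost-depthL (rises p q) r = rises (s≤s p) (s≤s q)

RisesAtMost⇒≤ : ∀ {e m m′ d d′} → RisesAtMost e m m′ → m ≡ just d → m′ ≡ just d′ → d′ ≤ d × d ≤ d′ + e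
RisesAtMost⇒≤ (rises p q) refl refl = p , q

module _ {c : ℕ → ℕ} where

  mutual
    winner : ∀ {t t′} → Step c t t′ → ℕ
    winner (winL {x = x} _) = x
    winner (winR {y = y} _) = y
    winner (inside s)       = winnerL s

    winnerL : ∀ {ts ts′} → StepL c ts ts′ → ℕ
    winnerL (here s)  = winner s
    winnerL (there s) = winnerL s

  mutual
    loser : ∀ {t t′} → Step c t t′ → ℕ
    loser (winL {y = y} _) = y
    loser (winR {x = x} _) = x
    loser (inside s)       = loserL s

    loserL : ∀ {ts ts′} → StepL c ts ts′ → ℕ
    loserL (here s)  = loser s
    loserL (there s) = loserL s

  mutual
    winner≤loser : ∀ {t t′} (s : Step c t t′) → c (winner s) ≤ c (loser s)
    winner≤loser (winL p)   = p
    winner≤loser (winR p)   = p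
    winner≤loser (inside s) = winnerL≤loserL s

    winnerL≤loserL : ∀ {ts ts′} (s : StepL c ts ts′) → c (winnerL s) ≤ c (loserL s)
    winnerL≤loserL (here s)  = winner≤loser s
    winnerL≤loserL (there s) = winnerL≤loserL s

  mutual
    vertices-step : ∀ {t t′} → Step c t t′ → vertices t ↭ vertices t′
    vertices-step (winL {x} {y} {xs} {ys} _)
      rewrite List.++-identityʳ (y ∷ verticesL ys) | List.++-identityʳ (y ∷ verticesL (ys ++ xs))
            | verticesL-++ ys xs
      = prep x (↭.++-comm (verticesL xs) (y ∷ verticesL ys))
    vertices-step (winR {x} {y} {xs} {ys} _)
      rewrite List.++-identityʳ (y ∷ verticesL ys) | List.++-identityʳ (x ∷ verticesL (xs ++ ys))
            | verticesL-++ xs ys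
      = ↭.shift y (x ∷ verticesL xs) (verticesL ys)
    vertices-step (inside {just v} s)  = prep v (verticesL-step s)
    vertices-step (inside {nothing} s) = verticesL-step s

    verticesL-step : ∀ {ts ts′} → StepL c ts ts′ → verticesL ts ↭ verticesL ts′
    verticesL-step (here {ts = ts} s) = ↭.++⁺ʳ (verticesL ts) (vertices-step s)
    verticesL-step (there {t = t} s)  = ↭.++⁺ˡ (vertices t) (verticesL-step s)

  Unique-step : ∀ {t t′} → Step c t t′ → Unique (vertices t) → Unique (vertices t′)
  Unique-step s = Unique-resp-↭ (vertices-step s)

  -- Only the winner moves: it takes the place of the Steiner node, the loser takes the
  -- winner's old place, and both old child lists stay at the same depth.
  mutual
    depth-step : ∀ {t t′} (s : Step c t t′) → Unique (vertices t) → ∀ w →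
                 RisesAtMost (δ (winner s) w) (depth w t) (depth w t′)
    depth-step (winL {x} {y} {xs} {ys} _) u w with x ≟ w
    ... | yes refl = rises z≤n ≤-refl
    ... | no _ with depthL w xs in w∈xs
    ...   | just _ with y ≟ w
    ...     | yes refl =
      ⊥-elim (Unique-++-disjoint (x ∷ verticesL xs) u (there (depthL⇒∈ w xs w∈xs)) (here refl))
    ...     | no _
      rewrite depthL-++ w ys xs
            | ∉⇒depthL≡nothing w ys
                (λ w∈ys → Unique-++-disjoint (x ∷ verticesL xs) u (there (depthL⇒∈ w xs w∈xs)) (there (∈-++⁺ˡ w∈ys)))
            | w∈xs
      = RisesAtMost-refl _ _
    depth-step (winL {x} {y} {xs} {ys} _) u w | no _ | nothing
      rewrite depthL-++ w ys xs | w∈xs | <∣>-identityʳ (depthL w ys) = RisesAtMost-refl _ _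
    depth-step (winR {x} {y} {xs} {ys} _) u w with y ≟ w
    ... | yes refl with x ≟ y
    ...   | yes refl = ⊥-elim (Unique-++-disjoint (x ∷ verticesL xs) u (here refl) (here refl))
    ...   | no _
      rewrite ∉⇒depthL≡nothing y xs (λ y∈xs → Unique-++-disjoint (x ∷ verticesL xs) u (there y∈xs) (here refl))
      = rises z≤n ≤-refl
    depth-step (winR {x} {y} {xs} {ys} _) u w | no _ with x ≟ w
    ... | yes refl = RisesAtMost-refl _ _
    ... | no _ rewrite depthL-++ w xs ys | map-<∣>-assoc suc (depthL w xs) (depthL w ys) nothing =
      RisesAtMost-refl _ _
    depth-step (inside {a} s) u w with isV w a
    ... | true  = RisesAtMost-refl _ _
    ... | false = depthL-step s (Unique-children {a} u) w

    depthL-step : ∀ {ts ts′} (s : StepL c ts ts′) → Unique (verticesL ts) → ∀ w →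
                  RisesAtMost (δ (winnerL s) w) (depthL w ts) (depthL w ts′)
    depthL-step (here {t} s) u w =
      RisesAtMost-depthL (depth-step s (Unique-++⁻ˡ (vertices t) u) w) (RisesAtMost-refl _ _)
    depthL-step (there {t} s) u w =
      RisesAtMost-depthL (RisesAtMost-refl _ (depth w t)) (depthL-step s (Unique-++⁻ʳ (vertices t) u) w)

  StepL-∈ : ∀ {ts ts′ t} → StepL c ts ts′ → t ∈ ts → t ∈ ts′ ⊎ ∃ λ t′ → Step c t t′ × t′ ∈ ts′
  StepL-∈ (here s)  (here refl) = inj₂ (_ , s , here refl)
  StepL-∈ (here s)  (there t∈ts) = inj₁ (there t∈ts)
  StepL-∈ (there s) (here refl) = inj₁ (here refl)
  StepL-∈ (there s) (there t∈ts) with StepL-∈ s t∈ts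
  ... | inj₁ t∈ts′ = inj₁ (there t∈ts′)
  ... | inj₂ (t′ , s′ , t′∈ts′) = inj₂ (t′ , s′ , there t′∈ts′)

  Ancestor-step : ∀ {t t′ u v} → Step c t t′ → Ancestor t u v → Ancestor t′ u v
  Ancestor-step (winL {x} {y} {xs} {ys} _) (in-child (here refl) (at-root v∈xs)) =
    at-root (∈-++⁺ˡ (there (∈-verticesL-++⁺ʳ ys xs v∈xs)))
  Ancestor-step (winL {x} {y} {xs} {ys} _) (in-child (here refl) (in-child t∈xs an)) =
    in-child (here refl) (in-child (∈-++⁺ʳ ys t∈xs) an)
  Ancestor-step (winL {x} {y} {xs} {ys} _) (in-child (there (here refl)) (at-root v∈ys)) =
    in-child (here refl) (at-root (∈-verticesL-++⁺ˡ ys xs v∈ys))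
  Ancestor-step (winL {x} {y} {xs} {ys} _) (in-child (there (here refl)) (in-child t∈ys an)) =
    in-child (here refl) (in-child (∈-++⁺ˡ t∈ys) an)
  Ancestor-step (winR {x} {y} {xs} {ys} _) (in-child (here refl) (at-root v∈xs)) =
    in-child (here refl) (at-root (∈-verticesL-++⁺ˡ xs ys v∈xs))
  Ancestor-step (winR {x} {y} {xs} {ys} _) (in-child (here refl) (in-child t∈xs an)) =
    in-child (here refl) (in-child (∈-++⁺ˡ t∈xs) an)
  Ancestor-step (winR {x} {y} {xs} {ys} _) (in-child (there (here refl)) (at-root v∈ys)) =
    at-root (∈-++⁺ˡ (there (∈-verticesL-++⁺ʳ xs ys v∈ys)))
  Ancestor-step (winR {x} {y} {xs} {ys} _) (in-child (there (here refl)) (in-child t∈ys an)) =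
    in-child (here refl) (in-child (∈-++⁺ʳ xs t∈ys) an)
  Ancestor-step (inside s) (at-root v∈ts) = at-root (↭.∈-resp-↭ (verticesL-step s) v∈ts)
  Ancestor-step (inside s) (in-child t∈ts an) with StepL-∈ s t∈ts
  ... | inj₁ t∈ts′ = in-child t∈ts′ an
  ... | inj₂ (t′ , s′ , t′∈ts′) = in-child t′∈ts′ (Ancestor-step s′ an)

  -- The depth of v does not increase and that of u drops by at most δ (winner s) u.
  dist-step : ∀ {H H′ u v} (s : Step c H H′) → Unique (vertices H) → Ancestor H u v → Ancestor H′ u v →
              dist H′ u v ≤ dist H u v + δ (winner s) u
  dist-step {H} {H′} {u} {v} s uq an an′
    with Ancestor⇒dist+depth uq an | Ancestor⇒dist+depth (Unique-step s uq) an′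
  ... | du , dv , eu , ev , d | du′ , dv′ , eu′ , ev′ , d′
    with RisesAtMost⇒≤ (depth-step s uq u) eu eu′ | RisesAtMost⇒≤ (depth-step s uq v) ev ev′
  ... | _ , du≤du′+e | dv′≤dv , _ = +-cancelʳ-≤ du′ (dist H′ u v) (dist H u v + e) (begin
    dist H′ u v + du′       ≡⟨ d′ ⟩
    dv′                     ≤⟨ dv′≤dv ⟩
    dv                      ≡⟨ sym d ⟩
    dist H u v + du         ≤⟨ +-monoʳ-≤ (dist H u v) du≤du′+e ⟩
    dist H u v + (du′ + e)  ≡⟨ cong (dist H u v +_) (+-comm du′ e) ⟩
    dist H u v + (e + du′)  ≡⟨ sym (+-assoc (dist H u v) e du′) ⟩
    dist H u v + e + du′    ∎)
    where
      e = δ (winner s) u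
      open ≤-Reasoning

module _ (c : ℕ → ℕ) where

  rootWeight : HTree → ℕ
  rootWeight (node (just v) _) = c v
  rootWeight (node nothing _)  = 0

  -- The total weight c of the pending vertices, i.e. those whose parent is a Steiner node;
  -- pendingL and pendingL⁺ sum over children of a vertex and of a Steiner node respectively.
  mutual
    pending : HTree → ℕ
    pending (node (just _) ts) = pendingL ts
    pending (node nothing ts)  = pendingL⁺ ts

    pendingL : List HTree → ℕ
    pendingL []       = 0
    pendingL (t ∷ ts) = pending t + pendingL ts

    pendingL⁺ : List HTree → ℕ
    pendingL⁺ []       = 0
    pendingL⁺ (t ∷ ts) = rootWeight t + pending t + pendingL⁺ ts

  pendingL-++ : ∀ xs ys → pendingL (xs ++ ys) ≡ pendingL xs + pendingL ys
  pendingL-++ []       ys = refl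
  pendingL-++ (x ∷ xs) ys = trans (cong (pending x +_) (pendingL-++ xs ys)) (sym (+-assoc (pending x) _ _))

  pendingL⁺-++ : ∀ xs ys → pendingL⁺ (xs ++ ys) ≡ pendingL⁺ xs + pendingL⁺ ys
  pendingL⁺-++ []       ys = refl
  pendingL⁺-++ (x ∷ xs) ys =
    trans (cong (rootWeight x + pending x +_) (pendingL⁺-++ xs ys)) (sym (+-assoc (rootWeight x + pending x) _ _))

  pendingL⁺-↭ : ∀ {xs ys} → xs ↭ ys → pendingL⁺ xs ≡ pendingL⁺ ys
  pendingL⁺-↭ ↭-reflexive = refl
  pendingL⁺-↭ (prep x p) = cong (rootWeight x + pending x +_) (pendingL⁺-↭ p)
  pendingL⁺-↭ (swap x y p) rewrite pendingL⁺-↭ p = x∙yz≈y∙xz (rootWeight x + pending x) (rootWeight y + pending y) _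
  pendingL⁺-↭ (↭-transitive p q) = trans (pendingL⁺-↭ p) (pendingL⁺-↭ q)

module _ {c : ℕ → ℕ} where

  -- The loser stops being pending; the winner may stay pending or stop being so.
  mutual
    pending⁺-step : ∀ {t t′} (s : Step c t t′) → rootWeight c t′ + pending c t′ + c (loser s) ≤ rootWeight c t + pending c t
    pending⁺-step (winL {x} {y} {xs} {ys} _) rewrite pendingL-++ c ys xs =
      ≤-reflexive (winner-left (c x) (c y) (pendingL c xs) (pendingL c ys))
      where
        winner-left : ∀ cx cy a b → cx + (b + a + 0) + cy ≡ 0 + (cx + a + (cy + b + 0))
        winner-left = solve-∀
    pending⁺-step (winR {x} {y} {xs} {ys} _) rewrite pendingL-++ c xs ys =
      ≤-reflexive (winner-right (c x) (c y) (pendingL c xs) (pendingL c ys))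
      where
        winner-right : ∀ cx cy a b → cy + (a + b + 0) + cx ≡ 0 + (cx + a + (cy + b + 0))
        winner-right = solve-∀
    pending⁺-step (inside {just v} {_} {ts′} s) =
      ≤-trans (≤-reflexive (+-assoc (c v) (pendingL c ts′) _)) (+-monoʳ-≤ (c v) (pendingL-step s))
    pending⁺-step (inside {nothing} s) = pendingL⁺-step s

    pending-step : ∀ {t t′} (s : Step c t t′) → pending c t′ + c (loser s) ≤ pending c t
    pending-step {t′ = t′} s@(winL _) =
      ≤-trans (+-monoˡ-≤ (c (loser s)) (m≤n+m (pending c t′) (rootWeight c t′))) (pending⁺-step s)
    pending-step {t′ = t′} s@(winR _) =
      ≤-trans (+-monoˡ-≤ (c (loser s)) (m≤n+m (pending c t′) (rootWeight c t′))) (pending⁺-step s)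
    pending-step (inside {just _} s)  = pendingL-step s
    pending-step (inside {nothing} s) = pendingL⁺-step s

    pendingL-step : ∀ {ts ts′} (s : StepL c ts ts′) → pendingL c ts′ + c (loserL s) ≤ pendingL c ts
    pendingL-step (here {t} {t′} {ts} s) =
      ≤-trans (≤-reflexive (xy∙z≈xz∙y (pending c t′) (pendingL c ts) (c (loser s)))) (+-monoˡ-≤ (pendingL c ts) (pending-step s))
    pendingL-step (there {t} {_} {ts′} s) =
      ≤-trans (≤-reflexive (+-assoc (pending c t) (pendingL c ts′) _)) (+-monoʳ-≤ (pending c t) (pendingL-step s))

    pendingL⁺-step : ∀ {ts ts′} (s : StepL c ts ts′) → pendingL⁺ c ts′ + c (loserL s) ≤ pendingL⁺ c ts
    pendingL⁺-step (here {t} {t′} {ts} s) =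
      ≤-trans (≤-reflexive (xy∙z≈xz∙y (rootWeight c t′ + pending c t′) (pendingL⁺ c ts) (c (loser s))))
              (+-monoˡ-≤ (pendingL⁺ c ts) (pending⁺-step s))
    pendingL⁺-step (there {t} {_} {ts′} s) =
      ≤-trans (≤-reflexive (+-assoc (rootWeight c t + pending c t) (pendingL⁺ c ts′) _))
              (+-monoʳ-≤ (rootWeight c t + pending c t) (pendingL⁺-step s))

outdegree : ℕ → List (ℕ × ℕ) → ℕ
outdegree x []       = 0
outdegree x (e ∷ es) = δ x (proj₁ e) + outdegree x es

Ancestral : HTree → ℕ × ℕ → Set
Ancestral H (u , v) = Ancestor H u v

sumDist-step : ∀ {c H H′} (s : Step c H H′) → Unique (vertices H) → ∀ es →
               All (Ancestral H) es → All (Ancestral H′) es →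
               sumDist H′ es ≤ sumDist H es + outdegree (winner s) es
sumDist-step s uq []             []       []         = z≤n
sumDist-step {H = H} s uq ((u , v) ∷ es) (an ∷ ans) (an′ ∷ ans′) =
  ≤-trans (+-mono-≤ (dist-step s uq an an′) (sumDist-step s uq es ans ans′))
          (≤-reflexive (interchange (dist H u v) (δ (winner s) u) (sumDist H es) _))

outdegree-++ : ∀ x es fs → outdegree x (es ++ fs) ≡ outdegree x es + outdegree x fs
outdegree-++ x []       fs = refl
outdegree-++ x (e ∷ es) fs = trans (cong (δ x (proj₁ e) +_) (outdegree-++ x es fs)) (sym (+-assoc (δ x (proj₁ e)) _ _))

outdegree-star : ∀ a (ts : List (Tree ℕ)) → outdegree a (map (λ t → (a , root t)) ts) ≡ length ts
outdegree-star a []       = refl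
outdegree-star a (t ∷ ts) rewrite ≟-diag {a} {a} refl = cong suc (outdegree-star a ts)

outdegree-star-≢ : ∀ x a (ts : List (Tree ℕ)) → x ≢ a → outdegree x (map (λ t → (a , root t)) ts) ≡ 0
outdegree-star-≢ x a []       x≢a = refl
outdegree-star-≢ x a (t ∷ ts) x≢a with x ≟ a
... | yes x≡a = ⊥-elim (x≢a x≡a)
... | no _    = outdegree-star-≢ x a ts x≢a

mutual
  outdegree-edges-∉ : ∀ x t → x ∉ labels t → outdegree x (edges t) ≡ 0
  outdegree-edges-∉ x (node a ts) x∉t
    rewrite outdegree-++ x (map (λ t → (a , root t)) ts) (edgesL ts)
          | outdegree-star-≢ x a ts (λ x≡a → x∉t (here x≡a))
    = outdegree-edgesL-∉ x ts (λ x∈ts → x∉t (there x∈ts))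

  outdegree-edgesL-∉ : ∀ x ts → x ∉ labelsL ts → outdegree x (edgesL ts) ≡ 0
  outdegree-edgesL-∉ x []       x∉ts = refl
  outdegree-edgesL-∉ x (t ∷ ts) x∉ts
    rewrite outdegree-++ x (edges t) (edgesL ts)
          | outdegree-edges-∉ x t (λ x∈t → x∉ts (∈-++⁺ˡ x∈t))
    = outdegree-edgesL-∉ x ts (λ x∈ts′ → x∉ts (∈-++⁺ʳ (labels t) x∈ts′))

mutual
  outdegree-edges≤childCount : ∀ x t → Unique (labels t) → outdegree x (edges t) ≤ childCount t x
  outdegree-edges≤childCount x (node a ts) uq
    rewrite outdegree-++ x (map (λ t → (a , root t)) ts) (edgesL ts) with a ≟ x
  ... | yes refl
    rewrite outdegree-star a ts | outdegree-edgesL-∉ a ts (Unique[x∷xs]⇒x∉xs uq) | +-identityʳ (length ts)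
    = ≤-refl
  ... | no a≢x rewrite outdegree-star-≢ x a ts (λ x≡a → a≢x (sym x≡a)) =
    outdegree-edgesL≤childCountL x ts (tail uq)

  outdegree-edgesL≤childCountL : ∀ x ts → Unique (labelsL ts) → outdegree x (edgesL ts) ≤ childCountL ts x
  outdegree-edgesL≤childCountL x []       uq = z≤n
  outdegree-edgesL≤childCountL x (t ∷ ts) uq rewrite outdegree-++ x (edges t) (edgesL ts) =
    +-mono-≤ (outdegree-edges≤childCount x t (Unique-++⁻ˡ (labels t) uq))
             (outdegree-edgesL≤childCountL x ts (Unique-++⁻ʳ (labels t) uq))

data Subtree : HTree → HTree → Set where
  self  : ∀ {t} → Subtree t t
  below : ∀ {h t a ts} → t ∈ ts → Subtree h t → Subtree h (node a ts)

Subtree-Ancestor : ∀ {h T u v} → Subtree h T → Ancestor h u v → Ancestor T u v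
Subtree-Ancestor self           an = an
Subtree-Ancestor (below t∈ts s) an = in-child t∈ts (Subtree-Ancestor s an)

Subtree-∈ : ∀ {h T w} → Subtree h T → w ∈ vertices h → w ∈ vertices T
Subtree-∈ self w∈h = w∈h
Subtree-∈ (below {a = just _} t∈ts s) w∈h = there (∈-verticesL t∈ts (Subtree-∈ s w∈h))
Subtree-∈ (below {a = nothing} t∈ts s) w∈h = ∈-verticesL t∈ts (Subtree-∈ s w∈h)

FullBin-vertices : ∀ {ls T} → FullBin ls T → vertices T ≡ verticesL ls
FullBin-vertices (leafB {h}) = sym (List.++-identityʳ (vertices h))
FullBin-vertices (brB {l₁} {l₂} {a} {b} f g)
  rewrite verticesL-++ l₁ l₂ | List.++-identityʳ (vertices b) | FullBin-vertices f | FullBin-vertices g = refl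

FullBin-Subtree : ∀ {ls T h} → FullBin ls T → h ∈ ls → Subtree h T
FullBin-Subtree leafB (here refl) = self
FullBin-Subtree (brB {l₁} f g) h∈ls with ∈-++⁻ l₁ h∈ls
... | inj₁ h∈l₁ = below (here refl) (FullBin-Subtree f h∈l₁)
... | inj₂ h∈l₂ = below (there (here refl)) (FullBin-Subtree g h∈l₂)

mutual
  BB-vertices : ∀ {t h} → BB t h → vertices h ↭ labels t
  BB-vertices bb-leaf = ↭-refl
  BB-vertices (bb-node {v} {T = T} bbs p f) rewrite List.++-identityʳ (vertices T) | FullBin-vertices f =
    prep v (↭-trans (verticesL-↭ (↭-sym p)) (BBs-vertices bbs))

  BBs-vertices : ∀ {cs hs} → BBs cs hs → verticesL hs ↭ labelsL cs
  BBs-vertices []         = ↭-refl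
  BBs-vertices (bb ∷ bbs) = ↭.++⁺ (BB-vertices bb) (BBs-vertices bbs)

BB-root : ∀ {t h} → BB t h → root t ∈ vertices h
BB-root bb-leaf          = here refl
BB-root (bb-node _ _ _) = here refl

BB-edges-ancestral : ∀ {t h} → BB t h → All (Ancestral h) (edges t)
BB-edges-ancestral bb-leaf = []
BB-edges-ancestral (bb-node {v} {T = T} bbs p f) =
  All.++⁺ (star bbs (λ h∈hs → FullBin-Subtree f (↭.∈-resp-↭ p h∈hs)))
          (below-children bbs (λ h∈hs → FullBin-Subtree f (↭.∈-resp-↭ p h∈hs)))
  where
    star : ∀ {cs hs} → BBs cs hs → (∀ {h} → h ∈ hs → Subtree h T) →
           All (Ancestral (node (just v) (T ∷ []))) (map (λ t → (v , root t)) cs)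
    star []         sub = []
    star (bb ∷ bbs) sub =
      at-root (∈-++⁺ˡ (Subtree-∈ (sub (here refl)) (BB-root bb))) ∷ star bbs (sub ∘′ there)

    below-children : ∀ {cs hs} → BBs cs hs → (∀ {h} → h ∈ hs → Subtree h T) →
                     All (Ancestral (node (just v) (T ∷ []))) (edgesL cs)
    below-children []         sub = []
    below-children (bb ∷ bbs) sub =
      All.++⁺ (All.map (λ an → in-child (here refl) (Subtree-Ancestor (sub (here refl)) an)) (BB-edges-ancestral bb))
              (below-children bbs (sub ∘′ there))

module _ (c : ℕ → ℕ) where

  mutual
    nonRootWeight : Tree ℕ → ℕ
    nonRootWeight (node _ cs) = forestWeight cs

    forestWeight : List (Tree ℕ) → ℕ
    forestWeight []       = 0
    forestWeight (t ∷ ts) = c (root t) + nonRootWeight t + forestWeight ts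

  FullBin-pending : ∀ {ls T} → FullBin ls T → rootWeight c T + pending c T ≤ pendingL⁺ c ls
  FullBin-pending (leafB {h}) = ≤-reflexive (sym (+-identityʳ _))
  FullBin-pending (brB {l₁} {l₂} {a} {b} f g)
    rewrite pendingL⁺-++ c l₁ l₂ | +-identityʳ (rootWeight c b + pending c b) =
    +-mono-≤ (FullBin-pending f) (FullBin-pending g)

  mutual
    BB-pending : ∀ {t h} → BB t h → pending c h ≤ nonRootWeight t
    BB-pending bb-leaf = z≤n
    BB-pending (bb-node {c = t} {cs} {hs} {ls} {T} bbs p f) = begin
      pending c T + 0              ≡⟨ +-identityʳ _ ⟩
      pending c T                  ≤⟨ m≤n+m _ _ ⟩
      rootWeight c T + pending c T ≤⟨ FullBin-pending f ⟩
      pendingL⁺ c ls               ≡⟨ sym (pendingL⁺-↭ c p) ⟩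
      pendingL⁺ c hs               ≤⟨ BBs-pending bbs ⟩
      forestWeight (t ∷ cs)        ∎
      where open ≤-Reasoning

    BBs-pending : ∀ {cs hs} → BBs cs hs → pendingL⁺ c hs ≤ forestWeight cs
    BBs-pending []                           = z≤n
    BBs-pending (bb-leaf {v} ∷ bbs)          = +-mono-≤ (+-monoʳ-≤ (c v) z≤n) (BBs-pending bbs)
    BBs-pending (bb@(bb-node {v} _ _ _) ∷ bbs) = +-mono-≤ (+-monoʳ-≤ (c v) (BB-pending bb)) (BBs-pending bbs)

  mutual
    ChildCountBounded : Tree ℕ → Set
    ChildCountBounded (node v cs) = c v ≤ length cs × ChildCountBoundedL cs

    ChildCountBoundedL : List (Tree ℕ) → Set
    ChildCountBoundedL []       = ⊤
    ChildCountBoundedL (t ∷ ts) = ChildCountBounded t × ChildCountBoundedL ts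

  forestWeight+length≤ : ∀ ts → ChildCountBoundedL ts → forestWeight ts + length ts ≤ length (labelsL ts)
  forestWeight+length≤ []                  _                  = z≤n
  forestWeight+length≤ (node v cs ∷ ts) ((cv≤ , bcs) , bts) = begin
    c v + forestWeight cs + forestWeight ts + suc (length ts)
      ≤⟨ +-monoˡ-≤ (suc (length ts)) (+-monoˡ-≤ (forestWeight ts) (+-monoˡ-≤ (forestWeight cs) cv≤)) ⟩
    length cs + forestWeight cs + forestWeight ts + suc (length ts)
      ≡⟨ regroup (length cs) (forestWeight cs) (forestWeight ts) (length ts) ⟩
    suc (forestWeight cs + length cs + (forestWeight ts + length ts))
      ≤⟨ s≤s (+-mono-≤ (forestWeight+length≤ cs bcs) (forestWeight+length≤ ts bts)) ⟩
    suc (length (labelsL cs) + length (labelsL ts))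
      ≡⟨ cong suc (sym (List.length-++ (labelsL cs))) ⟩
    length (labels (node v cs) ++ labelsL ts) ∎
    where
      open ≤-Reasoning
      regroup : ∀ k a b l → k + a + b + suc l ≡ suc (a + k + (b + l))
      regroup = solve-∀

mutual
  childCount-∉ : ∀ v t → v ∉ labels t → childCount t v ≡ 0
  childCount-∉ v (node a ts) v∉t with a ≟ v
  ... | yes refl = ⊥-elim (v∉t (here refl))
  ... | no _     = childCountL-∉ v ts (λ v∈ts → v∉t (there v∈ts))

  childCountL-∉ : ∀ v ts → v ∉ labelsL ts → childCountL ts v ≡ 0
  childCountL-∉ v []       v∉ts = refl
  childCountL-∉ v (t ∷ ts) v∉ts rewrite childCount-∉ v t (λ v∈t → v∉ts (∈-++⁺ˡ v∈t)) =
    childCountL-∉ v ts (λ v∈ts′ → v∉ts (∈-++⁺ʳ (labels t) v∈ts′))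

childCount-root : ∀ a ts → childCount (node a ts) a ≡ length ts
childCount-root a ts rewrite ≟-diag {a} {a} refl = refl

childCount-nonRoot : ∀ a ts v → a ≢ v → childCount (node a ts) v ≡ childCountL ts v
childCount-nonRoot a ts v a≢v with a ≟ v
... | yes a≡v = ⊥-elim (a≢v a≡v)
... | no _    = refl

-- With distinct labels, the child count in G agrees with the child count in each subtree.
module _ (c : ℕ → ℕ) where
  mutual
    ChildCountBounded-intro : ∀ t → Unique (labels t) → (∀ {v} → v ∈ labels t → c v ≤ childCount t v) →
                              ChildCountBounded c t
    ChildCountBounded-intro (node a ts) uq c≤ =
      ≤-trans (c≤ (here refl)) (≤-reflexive (childCount-root a ts)) ,
      ChildCountBoundedL-intro ts (tail uq) λ {v} v∈ts →
        ≤-trans (c≤ (there v∈ts))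
                (≤-reflexive (childCount-nonRoot a ts v (λ { refl → Unique[x∷xs]⇒x∉xs uq v∈ts })))

    ChildCountBoundedL-intro : ∀ ts → Unique (labelsL ts) → (∀ {v} → v ∈ labelsL ts → c v ≤ childCountL ts v) →
                               ChildCountBoundedL c ts
    ChildCountBoundedL-intro []       uq c≤ = tt
    ChildCountBoundedL-intro (t ∷ ts) uq c≤ =
      ChildCountBounded-intro t (Unique-++⁻ˡ (labels t) uq) (λ {v} v∈t →
        ≤-trans (c≤ (∈-++⁺ˡ v∈t))
                (≤-reflexive (trans (cong (childCount t v +_)
                                          (childCountL-∉ v ts (Unique-++-disjoint (labels t) uq v∈t)))
                                    (+-identityʳ _)))) ,
      ChildCountBoundedL-intro ts (Unique-++⁻ʳ (labels t) uq) (λ {v} v∈ts →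
        ≤-trans (c≤ (∈-++⁺ʳ (labels t) v∈ts))
                (≤-reflexive (cong (_+ childCountL ts v)
                                   (childCount-∉ v t (λ v∈t → Unique-++-disjoint (labels t) uq v∈t v∈ts)))))

nonRootWeight-childCount : ∀ G → Unique (labels G) → nonRootWeight (childCount G) G ≤ length (labels G) ∸ 1
nonRootWeight-childCount G@(node v cs) uq
  with ChildCountBounded-intro (childCount G) G uq (λ _ → ≤-refl)
... | _ , bcs = ≤-trans (m≤m+n (forestWeight (childCount G) cs) (length cs))
                        (forestWeight+length≤ (childCount G) cs bcs)

module Tournament (G : Tree ℕ) (uG : Unique (labels G)) where

  Invariant : HTree → Set
  Invariant H = Unique (vertices H) × All (Ancestral H) (edges G)

  potential : HTree → ℕ
  potential H = sumDist H (edges G) + pending (childCount G) H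

  BB-Invariant : ∀ {H} → BB G H → Invariant H
  BB-Invariant bb = Unique-resp-↭ (↭-sym (BB-vertices bb)) uG , BB-edges-ancestral bb

  Invariant-step : ∀ {H H′} → Step (childCount G) H H′ → Invariant H → Invariant H′
  Invariant-step s (uq , ans) = Unique-step s uq , All.map (Ancestor-step s) ans

  potential-step : ∀ {H H′} → Step (childCount G) H H′ → Invariant H → potential H′ ≤ potential H
  potential-step {H} {H′} s inv@(uq , ans) = +-cancelʳ-≤ (c y) (potential H′) (potential H) (begin
    D′ + P′ + c y   ≡⟨ +-assoc D′ P′ (c y) ⟩
    D′ + (P′ + c y) ≤⟨ +-mono-≤ D′≤D+cx (pending-step s) ⟩
    D + c x + P     ≤⟨ +-monoˡ-≤ P (+-monoʳ-≤ D (winner≤loser s)) ⟩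
    D + c y + P     ≡⟨ xy∙z≈xz∙y D (c y) P ⟩
    D + P + c y     ∎)
    where
      open ≤-Reasoning
      c = childCount G
      x = winner s
      y = loser s
      D = sumDist H (edges G)
      D′ = sumDist H′ (edges G)
      P = pending c H
      P′ = pending c H′
      D′≤D+cx : D′ ≤ D + c x
      D′≤D+cx = ≤-trans (sumDist-step s uq (edges G) ans (proj₂ (Invariant-step s inv)))
                        (+-monoʳ-≤ D (outdegree-edges≤childCount x G uG))

  potential-run : ∀ {H H′} → Star (Step (childCount G)) H H′ → Invariant H → potential H′ ≤ potential H
  potential-run ε        inv = ≤-refl
  potential-run (s ◅ ss) inv = ≤-trans (potential-run ss (Invariant-step s inv)) (potential-step s inv)

-- The bound holds after any number of matches.
lemma6 : (n : ℕ) (G : Tree ℕ) → Unique (labels G) → length (labels G) ≡ n →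
         (H₀ H₁ : HTree) → BB G H₀ →
         Star (Step (childCount G)) H₀ H₁ → All Is-just (labels H₁) →
         sumDist H₁ (edges G) ≤ sumDist H₀ (edges G) + (n ∸ 1)
lemma6 n G uG refl H₀ H₁ bb run _ = begin
  sumDist H₁ (edges G)                                  ≤⟨ m≤m+n _ _ ⟩
  potential H₁                                          ≤⟨ potential-run run (BB-Invariant bb) ⟩
  sumDist H₀ (edges G) + pending (childCount G) H₀      ≤⟨ +-monoʳ-≤ _ (BB-pending (childCount G) bb) ⟩
  sumDist H₀ (edges G) + nonRootWeight (childCount G) G ≤⟨ +-monoʳ-≤ _ (nonRootWeight-childCount G uG) ⟩
  sumDist H₀ (edges G) + (length (labels G) ∸ 1)        ∎
  where
    open Tournament G uG
    open ≤-Reasoning
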